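{- Let $r\geq 1$ be an integer and let $G$ be a graph on $n$ vertices with $\delta(G)\geq r$ and $\mathrm{girth}(G)>r+1$. Then $\mathrm{gon}_r(G)\leq n-\alpha_r(G)$.
   Context: A graph is a finite, connected, undirected multigraph (parallel edges allowed, loops not allowed). $\delta(G)$ is the minimum valence of a vertex; the girth is the minimum length of a cycle (a pair of parallel edges is a cycle of length $2$). For vertices $u,v$, $d(u,v)$ is the graph distance. The $k$-independence number $\alpha_k(G)$ is the maximum size of a set $S\subseteq V(G)$ with $d(u,v)>k$ for all distinct $u,v\in S$. A divisor is a formal integer combination $D=\sum_v D(v)\,(v)$ of vertices; $\deg D=\sum_v D(v)$; $D$ is effective if $D(v)\geq 0$ for all $v$. Firing a vertex $v$ transforms $D$ into $D'$ with $D'(v)=D(v)-\mathrm{val}(v)$ and $D'(w)=D(w)+(\text{number of edges between } v \text{ and } w)$ for $w\neq v$; two divisors are linearly equivalent if one is obtained from the other by a finite sequence of firings. The rank $r(D)$ is $-1$ if $D$ is not equivalent to an effective divisor, and otherwise the largest integer $r\ge 0$ such that for every effective divisor $E$ of degree $r$, $D-E$ is linearly equivalent to an effective divisor. The $r$-th gonality $\mathrm{gon}_r(G)$ is the minimum degree of a divisor of rank at least $r$ on $G$. -}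

module Defs where

open import Data.Nat using (ℕ; zero; suc; _≤_; _<_)
open import Data.Integer as ℤ using (ℤ; +_; _+_; _-_)
open import Data.Fin using (Fin; zero; suc; inject₁; fromℕ; _≟_)
open import Data.Fin.Subset using (Subset; _∈_)
open import Data.List using (List; []; _∷_)
open import Data.Product using (Σ; ∃; _×_; _,_)
open import Data.Sum using (_⊎_)
open import Function.Definitions using (Injective)
open import Relation.Binary.PropositionalEquality using (_≡_)
open import Relation.Nullary using (¬_; yes; no)

sumℕ : ∀ {n} → (Fin n → ℕ) → ℕ
sumℕ {zero} f = 0
sumℕ {suc n} f = f zero Data.Nat.+ sumℕ (λ i → f (suc i))

sumℤ : ∀ {n} → (Fin n → ℤ) → ℤ
sumℤ {zero} f = + 0
sumℤ {suc n} f = f zero + sumℤ (λ i → f (suc i))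

record MultiGraph (n : ℕ) : Set where
  field
    mult     : Fin n → Fin n → ℕ
    symm     : ∀ u v → mult u v ≡ mult v u
    loopless : ∀ v → mult v v ≡ 0

  val : Fin n → ℕ
  val v = sumℕ (mult v)

  data Reach : ℕ → Fin n → Fin n → Set where
    here : ∀ {k u} → Reach k u u
    step : ∀ {k u w v} → 1 ≤ mult u w → Reach k w v → Reach (suc k) u v

open MultiGraph public

Connected : ∀ {n} → MultiGraph n → Set
Connected G = ∀ u v → ∃ λ k → Reach G k u v

MinValAtLeast : ∀ {n} → MultiGraph n → ℕ → Set
MinValAtLeast G r = ∀ v → r ≤ val G v

-- G has a cycle of length k (parallel edge pair = cycle of length 2;
-- for k ≥ 3 a cycle is a cyclic sequence of k distinct vertices, consecutive ones adjacent)
HasCycleOfLength : ∀ {n} → MultiGraph n → ℕ → Set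
HasCycleOfLength {n} G k =
  (k ≡ 2 × ∃ λ u → ∃ λ v → 2 ≤ mult G u v)
  ⊎ (Σ ℕ λ j → k ≡ suc j × 3 ≤ k ×
      Σ (Fin (suc j) → Fin n) λ f → Injective _≡_ _≡_ f ×
        (∀ (i : Fin j) → 1 ≤ mult G (f (inject₁ i)) (f (suc i))) ×
        1 ≤ mult G (f (fromℕ j)) (f zero))

GirthGreaterThan : ∀ {n} → MultiGraph n → ℕ → Set
GirthGreaterThan G g = ∀ k → HasCycleOfLength G k → g < k

Independent : ∀ {n} → MultiGraph n → ℕ → Subset n → Set
Independent G k S = ∀ u v → u ∈ S → v ∈ S → ¬ (u ≡ v) → ¬ Reach G k u v

Divisor : ℕ → Set
Divisor n = Fin n → ℤ

deg : ∀ {n} → Divisor n → ℤ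
deg D = sumℤ D

fire : ∀ {n} → MultiGraph n → Fin n → Divisor n → Divisor n
fire G v D w with w ≟ v
... | yes _ = D w - + val G v
... | no  _ = D w + + mult G v w

fireList : ∀ {n} → MultiGraph n → List (Fin n) → Divisor n → Divisor n
fireList G [] D = D
fireList G (v ∷ vs) D = fireList G vs (fire G v D)

-- D is linearly equivalent to an effective divisor
EquivEffective : ∀ {n} → MultiGraph n → Divisor n → Set
EquivEffective G D = ∃ λ (vs : List (Fin _)) → ∀ w → + 0 ℤ.≤ fireList G vs D w

RankAtLeast : ∀ {n} → MultiGraph n → Divisor n → ℕ → Set
RankAtLeast {n} G D r =
  (E : Fin n → ℕ) → sumℕ E ≡ r → EquivEffective G (λ w → D w - + E w)

{-# OPTIONS --safe #-}
-- Take D to be the sum of the vertices outside S, of degree n − |S|. Given an effective E of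
-- degree r, grow a vertex set U from ∅, adding any x ∉ U whose chips E(x), mark [x ∈ S] and
-- edges into U total at least 2. Once no such vertex is left, firing every vertex outside U
-- turns D − E into an effective divisor: a vertex x ∉ U keeps D(x) − E(x) − e(x,U) ≥ 0, and a
-- vertex w ∈ U needs E(w) + e(w,U) ≤ val(w) + D(w), which follows from val(w) ≥ r once
-- E(w) + e(w,U) ≤ E(U) + D(w).
-- That last bound comes from a potential: the additions keep 2E(U) + 2|U ∩ S| + 2e(U) ≥ 4|U|,
-- while on at most r + 1 vertices the girth forces a forest, and r-independence of S allows at
-- most one marked vertex per tree, so e(U) + |U ∩ S| ≤ |U|; in particular |U| ≤ E(U) ≤ r.
module Submission where

open import Defs
open import Data.Bool using (Bool; true; false; not; _∧_; _∨_)
open import Data.Bool.Properties using (¬-not; ∧-zeroʳ) renaming (_≟_ to _≟ᵇ_)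
open import Data.Fin using (Fin; zero; suc; _≟_; inject₁; fromℕ)
open import Data.Fin.Properties using (any?)
open import Data.Fin.Subset using (Subset; ∣_∣)
open import Data.Integer as ℤ using (ℤ; +_; _-_; +≤+)
import Data.Integer.Properties as ℤₚ
import Data.Integer.Tactic.RingSolver as ℤ-Solver
open import Data.List using (List; []; _∷_; _++_; [_]; length; lookup; map)
open import Data.List.Membership.Propositional using (_∈_)
open import Data.List.Membership.Propositional.Properties using (∈-lookup; ∈-∃++)
open import Data.List.Properties using (++-assoc; length-++; map-∘)
open import Data.List.Relation.Unary.All as All using (All; []; _∷_)
open import Data.List.Relation.Unary.All.Properties using (++⁻ˡ; ¬Any⇒All¬)
open import Data.List.Relation.Unary.Any using (here; there)
open import Data.List.Relation.Unary.Linked using (Linked; []; [-]; _∷_)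
open import Data.List.Relation.Unary.Unique.Propositional using (Unique; []; _∷_)
open import Data.Nat using (ℕ; zero; suc; _+_; _*_; _≤_; z≤n; s≤s; _≤?_)
open import Data.Nat.ListAction using (sum)
open import Data.Nat.Properties hiding (_≟_)
open import Data.Nat.Tactic.RingSolver using (solve-∀)
open import Data.Product using (∃; _×_; _,_)
open import Data.Sum using (inj₁; inj₂)
open import Data.Vec using ([]; _∷_)
import Data.Vec as Vec
open import Data.Vec.Properties using (lookup⇒[]=)
open import Function using (_∘_)
open import Relation.Binary.PropositionalEquality
  using (_≡_; _≢_; refl; sym; trans; cong; cong₂; subst; subst₂; module ≡-Reasoning)
open import Relation.Nullary using (¬_; yes; no; does; contradiction)
open import Relation.Nullary.Decidable using (¬?; _×-dec_)

+-interchange : ∀ a b c d → a + b + (c + d) ≡ a + c + (b + d)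
+-interchange = solve-∀

sumℕ-cong : ∀ {n} {f g : Fin n → ℕ} → (∀ i → f i ≡ g i) → sumℕ f ≡ sumℕ g
sumℕ-cong {zero}  f≗g = refl
sumℕ-cong {suc n} f≗g = cong₂ _+_ (f≗g zero) (sumℕ-cong (f≗g ∘ suc))

sumℕ-+ : ∀ {n} (f g : Fin n → ℕ) → sumℕ (λ i → f i + g i) ≡ sumℕ f + sumℕ g
sumℕ-+ {zero}  f g = refl
sumℕ-+ {suc n} f g = trans (cong (_+_ (f zero + g zero)) (sumℕ-+ (f ∘ suc) (g ∘ suc)))
                           (+-interchange (f zero) (g zero) _ _)

sumℕ-mono-≤ : ∀ {n} {f g : Fin n → ℕ} → (∀ i → f i ≤ g i) → sumℕ f ≤ sumℕ g
sumℕ-mono-≤ {zero}  f≤g = z≤n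
sumℕ-mono-≤ {suc n} f≤g = +-mono-≤ (f≤g zero) (sumℕ-mono-≤ (f≤g ∘ suc))

sumℕ-zero : ∀ {n} {f : Fin n → ℕ} → (∀ i → f i ≡ 0) → sumℕ f ≡ 0
sumℕ-zero {zero}  f≗0 = refl
sumℕ-zero {suc n} f≗0 = cong₂ _+_ (f≗0 zero) (sumℕ-zero (f≗0 ∘ suc))

sumℕ-one : ∀ n → sumℕ {n} (λ _ → 1) ≡ n
sumℕ-one zero    = refl
sumℕ-one (suc n) = cong suc (sumℕ-one n)

𝟙 : Bool → ℕ
𝟙 true  = 1
𝟙 false = 0

𝟙≤1 : ∀ b → 𝟙 b ≤ 1
𝟙≤1 true  = ≤-refl
𝟙≤1 false = z≤n

𝟙-not+𝟙 : ∀ b → 𝟙 (not b) + 𝟙 b ≡ 1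
𝟙-not+𝟙 true  = refl
𝟙-not+𝟙 false = refl

𝟙[_≟_] : ∀ {n} → Fin n → Fin n → ℕ
𝟙[ i ≟ x ] = 𝟙 (does (i ≟ x))

sumℕ-point : ∀ {n} (x : Fin n) (f : Fin n → ℕ) → sumℕ (λ i → 𝟙[ i ≟ x ] * f i) ≡ f x
sumℕ-point {suc n} zero f =
  trans (cong₂ _+_ (+-identityʳ (f zero)) (sumℕ-zero {f = λ i → 𝟙[ suc i ≟ zero ] * f (suc i)} λ _ → refl))
        (+-identityʳ (f zero))
sumℕ-point {suc n} (suc x) f = sumℕ-point x (f ∘ suc)

Subsetᶠ : ℕ → Set
Subsetᶠ n = Fin n → Bool

Σ[_] : ∀ {n} → Subsetᶠ n → (Fin n → ℕ) → ℕ
Σ[ P ] f = sumℕ (λ i → 𝟙 (P i) * f i)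

size : ∀ {n} → Subsetᶠ n → ℕ
size P = Σ[ P ] (λ _ → 1)

marks : ∀ {n} → Subsetᶠ n → Subsetᶠ n → ℕ
marks S P = Σ[ P ] (𝟙 ∘ S)

∅ : ∀ {n} → Subsetᶠ n
∅ _ = false

∁ : ∀ {n} → Subsetᶠ n → Subsetᶠ n
∁ P i = not (P i)

insert : ∀ {n} → Fin n → Subsetᶠ n → Subsetᶠ n
insert x P i = does (i ≟ x) ∨ P i

delete : ∀ {n} → Fin n → Subsetᶠ n → Subsetᶠ n
delete x P i = not (does (i ≟ x)) ∧ P i

module _ {n : ℕ} where

  Σ-congˢ : ∀ {P Q : Subsetᶠ n} (f : Fin n → ℕ) → (∀ i → P i ≡ Q i) → Σ[ P ] f ≡ Σ[ Q ] f
  Σ-congˢ f P≗Q = sumℕ-cong (λ i → cong (λ b → 𝟙 b * f i) (P≗Q i))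

  Σ-congᶠ : ∀ (P : Subsetᶠ n) {f g : Fin n → ℕ} → (∀ i → P i ≡ true → f i ≡ g i) → Σ[ P ] f ≡ Σ[ P ] g
  Σ-congᶠ P {f} {g} f≗g = sumℕ-cong termwise
    where
    termwise : ∀ i → 𝟙 (P i) * f i ≡ 𝟙 (P i) * g i
    termwise i with P i in i∈P
    ... | true  = cong (_+ 0) (f≗g i i∈P)
    ... | false = refl

  Σ-+ : ∀ (P : Subsetᶠ n) (f g : Fin n → ℕ) → Σ[ P ] (λ i → f i + g i) ≡ Σ[ P ] f + Σ[ P ] g
  Σ-+ P f g = trans (sumℕ-cong (λ i → *-distribˡ-+ (𝟙 (P i)) (f i) (g i)))
                    (sumℕ-+ (λ i → 𝟙 (P i) * f i) (λ i → 𝟙 (P i) * g i))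

  Σ≤sumℕ : ∀ (P : Subsetᶠ n) (f : Fin n → ℕ) → Σ[ P ] f ≤ sumℕ f
  Σ≤sumℕ P f = sumℕ-mono-≤ termwise
    where
    termwise : ∀ i → 𝟙 (P i) * f i ≤ f i
    termwise i with P i
    ... | true  = ≤-reflexive (+-identityʳ (f i))
    ... | false = z≤n

  Σ-empty : ∀ (P : Subsetᶠ n) (f : Fin n → ℕ) → (∀ i → P i ≡ false) → Σ[ P ] f ≡ 0
  Σ-empty P f P≗∅ = sumℕ-zero (λ i → cong (λ b → 𝟙 b * f i) (P≗∅ i))

  sumℕ-split : ∀ (P : Subsetᶠ n) (f : Fin n → ℕ) → sumℕ f ≡ Σ[ P ] f + Σ[ ∁ P ] f
  sumℕ-split P f = trans (sumℕ-cong termwise) (sumℕ-+ (λ i → 𝟙 (P i) * f i) (λ i → 𝟙 (∁ P i) * f i))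
    where
    termwise : ∀ i → f i ≡ 𝟙 (P i) * f i + 𝟙 (not (P i)) * f i
    termwise i with P i
    ... | true  = sym (trans (+-identityʳ (f i + 0)) (+-identityʳ (f i)))
    ... | false = sym (+-identityʳ (f i))

  Σ-point : ∀ (P : Subsetᶠ n) (x : Fin n) (f : Fin n → ℕ) → Σ[ P ] (λ i → 𝟙[ i ≟ x ] * f i) ≡ 𝟙 (P x) * f x
  Σ-point P x f = trans (sumℕ-cong (λ i → *-comm-middle (𝟙 (P i)) 𝟙[ i ≟ x ] (f i))) (sumℕ-point x _)
    where
    *-comm-middle : ∀ a b c → a * (b * c) ≡ b * (a * c)
    *-comm-middle = solve-∀

  Σ-insert : ∀ (P : Subsetᶠ n) {x} (f : Fin n → ℕ) → P x ≡ false → Σ[ insert x P ] f ≡ f x + Σ[ P ] f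
  Σ-insert P {x} f x∉P = begin
    Σ[ insert x P ] f                                       ≡⟨ sumℕ-cong termwise ⟩
    sumℕ (λ i → 𝟙[ i ≟ x ] * f i + 𝟙 (P i) * f i)
      ≡⟨ sumℕ-+ (λ i → 𝟙[ i ≟ x ] * f i) (λ i → 𝟙 (P i) * f i) ⟩
    sumℕ (λ i → 𝟙[ i ≟ x ] * f i) + Σ[ P ] f                ≡⟨ cong (_+ Σ[ P ] f) (sumℕ-point x f) ⟩
    f x + Σ[ P ] f                                          ∎
    where
    open ≡-Reasoning
    termwise : ∀ i → 𝟙 (insert x P i) * f i ≡ 𝟙[ i ≟ x ] * f i + 𝟙 (P i) * f i
    termwise i with i ≟ x
    ... | yes refl rewrite x∉P = sym (+-identityʳ (f i + 0))
    ... | no _     = refl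

  insert-delete : ∀ {P : Subsetᶠ n} {x} → P x ≡ true → ∀ i → insert x (delete x P) i ≡ P i
  insert-delete {x = x} x∈P i with i ≟ x
  ... | yes refl = sym x∈P
  ... | no _     = refl

  delete-self : ∀ (P : Subsetᶠ n) x → delete x P x ≡ false
  delete-self P x with x ≟ x
  ... | yes _   = refl
  ... | no x≢x  = contradiction refl x≢x

  delete-insert : ∀ {P : Subsetᶠ n} {x} → P x ≡ false → ∀ i → delete x (insert x P) i ≡ P i
  delete-insert {x = x} x∉P i with i ≟ x
  ... | yes refl = sym x∉P
  ... | no _     = refl

  delete-insert-comm : ∀ (P : Subsetᶠ n) {t x} → t ≢ x → ∀ i → delete t (insert x P) i ≡ insert x (delete t P) i
  delete-insert-comm P {t} {x} t≢x i with i ≟ t | i ≟ x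
  ... | yes refl | yes refl = contradiction refl t≢x
  ... | yes _    | no _     = refl
  ... | no _     | yes _    = refl
  ... | no _     | no _     = refl

  Σ-delete : ∀ (P : Subsetᶠ n) {x} (f : Fin n → ℕ) → P x ≡ true → Σ[ P ] f ≡ f x + Σ[ delete x P ] f
  Σ-delete P {x} f x∈P =
    trans (sym (Σ-congˢ f (insert-delete x∈P))) (Σ-insert (delete x P) f (delete-self P x))

  size-zero : ∀ (P : Subsetᶠ n) → size P ≡ 0 → ∀ i → P i ≡ false
  size-zero P size≡0 i with P i in i∈P
  ... | false = refl
  ... | true  = contradiction (trans (sym (Σ-delete P (λ _ → 1) i∈P)) size≡0) λ ()

  size≤n : ∀ (P : Subsetᶠ n) → size P ≤ n
  size≤n P = subst (size P ≤_) (sumℕ-one n) (Σ≤sumℕ P _)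

elements : ∀ {n} → Subsetᶠ n → List (Fin n)
elements {zero}  P = []
elements {suc n} P with P zero
... | true  = zero ∷ map suc (elements (P ∘ suc))
... | false = map suc (elements (P ∘ suc))

sum-map-suc : ∀ {n} (P : Subsetᶠ (suc n)) (f : Fin (suc n) → ℕ) →
  sum (map f (map suc (elements (P ∘ suc)))) ≡ Σ[ P ∘ suc ] (f ∘ suc)

sum-elements : ∀ {n} (P : Subsetᶠ n) (f : Fin n → ℕ) → sum (map f (elements P)) ≡ Σ[ P ] f
sum-elements {zero}  P f = refl
sum-elements {suc n} P f with P zero
... | true  = cong₂ _+_ (sym (+-identityʳ (f zero))) (sum-map-suc P f)
... | false = sum-map-suc P f

sum-map-suc P f = trans (cong sum (sym (map-∘ (elements (P ∘ suc))))) (sum-elements (P ∘ suc) (f ∘ suc))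

Unique-++⁻ˡ : ∀ {n} (xs : List (Fin n)) {ys} → Unique (xs ++ ys) → Unique xs
Unique-++⁻ˡ []       _               = []
Unique-++⁻ˡ (x ∷ xs) (x∉xs++ys ∷ u) = ++⁻ˡ xs x∉xs++ys ∷ Unique-++⁻ˡ xs u

lookup-injective : ∀ {n} {xs : List (Fin n)} → Unique xs → ∀ {i j} → lookup xs i ≡ lookup xs j → i ≡ j
lookup-injective {xs = x ∷ xs} (x∉xs ∷ u) {zero}  {zero}  _ = refl
lookup-injective {xs = x ∷ xs} (x∉xs ∷ u) {zero}  {suc j} e = contradiction e (All.lookup x∉xs (∈-lookup j))
lookup-injective {xs = x ∷ xs} (x∉xs ∷ u) {suc i} {zero}  e = contradiction (sym e) (All.lookup x∉xs (∈-lookup i))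
lookup-injective {xs = x ∷ xs} (x∉xs ∷ u) {suc i} {suc j} e = cong suc (lookup-injective u e)

module Walks {n : ℕ} (G : MultiGraph n) where

  Adj : Fin n → Fin n → Set
  Adj u v = 1 ≤ mult G u v

  adj-sym : ∀ {u v} → Adj u v → Adj v u
  adj-sym {u} {v} = subst (1 ≤_) (symm G u v)

  adj-irrefl : ∀ {v} → ¬ Adj v v
  adj-irrefl {v} = n≮0 ∘ subst (1 ≤_) (loopless G v)

  ¬adj⇒mult≡0 : ∀ {u v} → ¬ Adj u v → mult G u v ≡ 0
  ¬adj⇒mult≡0 {u} {v} ¬u~v with mult G u v
  ... | zero  = refl
  ... | suc _ = contradiction (s≤s z≤n) ¬u~v

  Linked-++⁻ˡ : ∀ xs {ys} → Linked Adj (xs ++ ys) → Linked Adj xs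
  Linked-++⁻ˡ []           _          = []
  Linked-++⁻ˡ (x ∷ [])     _          = [-]
  Linked-++⁻ˡ (x ∷ y ∷ xs) (a ∷ link) = a ∷ Linked-++⁻ˡ (y ∷ xs) link

  end : Fin n → List (Fin n) → Fin n
  end y []       = y
  end y (x ∷ xs) = end x xs

  end-∈ : ∀ y xs → end y xs ∈ y ∷ xs
  end-∈ y []       = here refl
  end-∈ y (x ∷ xs) = there (end-∈ x xs)

  end-∷ʳ : ∀ y xs z → end y (xs ++ [ z ]) ≡ z
  end-∷ʳ y []       z = refl
  end-∷ʳ y (x ∷ xs) z = end-∷ʳ x xs z

  lookup-end : ∀ y xs → lookup (y ∷ xs) (fromℕ (length xs)) ≡ end y xs
  lookup-end y []       = refl
  lookup-end y (x ∷ xs) = lookup-end x xs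

  lookup-linked : ∀ {y xs} → Linked Adj (y ∷ xs) →
    ∀ (i : Fin (length xs)) → Adj (lookup (y ∷ xs) (inject₁ i)) (lookup (y ∷ xs) (suc i))
  lookup-linked (a ∷ link) zero    = a
  lookup-linked (a ∷ link) (suc i) = lookup-linked link i

  reach-mono : ∀ {k l u v} → k ≤ l → Reach G k u v → Reach G l u v
  reach-mono _         here         = here
  reach-mono (s≤s k≤l) (step a rch) = step a (reach-mono k≤l rch)

  linked⇒reach : ∀ {y xs} → Linked Adj (y ∷ xs) → Reach G (length xs) y (end y xs)
  linked⇒reach {xs = []}     [-]        = here
  linked⇒reach {xs = x ∷ xs} (a ∷ link) = step a (linked⇒reach link)

  closed-path⇒cycle : ∀ {y xs} → Unique (y ∷ xs) → Linked Adj (y ∷ xs) → 3 ≤ suc (length xs) →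
    Adj (end y xs) y → HasCycleOfLength G (suc (length xs))
  closed-path⇒cycle {y} {xs} u link 3≤len closing =
    inj₂ (length xs , refl , 3≤len , lookup (y ∷ xs) , lookup-injective u ,
          lookup-linked link , subst (λ v → Adj v y) (sym (lookup-end y xs)) closing)

  chord⇒cycle : ∀ {y p rest z} → Unique (y ∷ p ∷ rest) → Linked Adj (y ∷ p ∷ rest) →
    z ∈ rest → Adj y z → ∃ λ k → k ≤ length (y ∷ p ∷ rest) × HasCycleOfLength G k
  chord⇒cycle {y} {p} {rest} {z} u link z∈rest y~z with ∈-∃++ z∈rest
  ... | pre , post , refl =
    suc (length cycle) , cycle-length≤ ,
    closed-path⇒cycle (Unique-++⁻ˡ (y ∷ cycle) (subst Unique split u))
                      (Linked-++⁻ˡ (y ∷ cycle) (subst (Linked Adj) split link))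
                      (s≤s (s≤s (subst (1 ≤_) (sym (length-++ pre)) (m≤n+m 1 (length pre)))))
                      (subst (λ v → Adj v y) (sym (end-∷ʳ p pre z)) (adj-sym y~z))
    where
    cycle : List (Fin n)
    cycle = p ∷ pre ++ [ z ]
    split : y ∷ p ∷ pre ++ z ∷ post ≡ (y ∷ cycle) ++ post
    split = cong (λ w → y ∷ p ∷ w) (sym (++-assoc pre [ z ] post))
    cycle-length≤ : suc (length cycle) ≤ length (y ∷ p ∷ pre ++ z ∷ post)
    cycle-length≤ rewrite length-++ pre {[ z ]} | length-++ pre {z ∷ post} =
      s≤s (s≤s (+-monoʳ-≤ (length pre) (s≤s z≤n)))

module Induced {n : ℕ} (G : MultiGraph n) where

  degIn : Fin n → Subsetᶠ n → ℕ
  degIn x P = Σ[ P ] (mult G x)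

  degSum : Subsetᶠ n → ℕ
  degSum P = Σ[ P ] (λ y → degIn y P)

  degSum-cong : ∀ {P Q : Subsetᶠ n} → (∀ i → P i ≡ Q i) → degSum P ≡ degSum Q
  degSum-cong P≗Q = sumℕ-cong (λ i → cong₂ (λ b d → 𝟙 b * d) (P≗Q i) (Σ-congˢ (mult G i) P≗Q))

  degIn-delete-self : ∀ {P : Subsetᶠ n} x → P x ≡ true → degIn x P ≡ degIn x (delete x P)
  degIn-delete-self {P} x x∈P = trans (Σ-delete P (mult G x) x∈P) (cong (_+ degIn x (delete x P)) (loopless G x))

  degSum-insert : ∀ {P : Subsetᶠ n} x → P x ≡ false → degSum (insert x P) ≡ 2 * degIn x P + degSum P
  degSum-insert {P} x x∉P = begin
    degSum (insert x P)                                 ≡⟨ Σ-congᶠ (insert x P) (λ y _ → Σ-insert P (mult G y) x∉P) ⟩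
    Σ[ insert x P ] (λ y → mult G y x + degIn y P)      ≡⟨ Σ-insert P (λ y → mult G y x + degIn y P) x∉P ⟩
    (mult G x x + degIn x P) + Σ[ P ] (λ y → mult G y x + degIn y P)
      ≡⟨ cong₂ _+_ (cong (_+ degIn x P) (loopless G x)) (Σ-+ P (λ y → mult G y x) (λ y → degIn y P)) ⟩
    degIn x P + (Σ[ P ] (λ y → mult G y x) + degSum P)
      ≡⟨ cong (λ e → degIn x P + (e + degSum P)) (Σ-congᶠ P (λ y _ → symm G y x)) ⟩
    degIn x P + (degIn x P + degSum P)                  ≡⟨ twice (degIn x P) (degSum P) ⟩
    2 * degIn x P + degSum P                            ∎
    where
    open ≡-Reasoning
    twice : ∀ a b → a + (a + b) ≡ 2 * a + b
    twice = solve-∀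

  degSum-delete : ∀ {P : Subsetᶠ n} x → P x ≡ true → degSum P ≡ 2 * degIn x P + degSum (delete x P)
  degSum-delete {P} x x∈P = begin
    degSum P                                            ≡⟨ degSum-cong (λ i → sym (insert-delete x∈P i)) ⟩
    degSum (insert x (delete x P))                      ≡⟨ degSum-insert x (delete-self P x) ⟩
    2 * degIn x (delete x P) + degSum (delete x P)
      ≡⟨ cong (λ d → 2 * d + degSum (delete x P)) (sym (degIn-delete-self {P} x x∈P)) ⟩
    2 * degIn x P + degSum (delete x P)                 ∎
    where open ≡-Reasoning

module Forest (r : ℕ) (1≤r : 1 ≤ r) {n : ℕ} (G : MultiGraph n) (girth : GirthGreaterThan G (r + 1))
  (marked : Subsetᶠ n)
  (apart : ∀ u v → marked u ≡ true → marked v ≡ true → u ≢ v → ¬ Reach G r u v) where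

  open Walks G
  open Induced G
  open import Data.List.Membership.DecPropositional (_≟_ {n = n}) using (_∈?_)

  mult≤1 : ∀ u v → mult G u v ≤ 1
  mult≤1 u v with 2 ≤? mult G u v
  ... | yes 2≤m = contradiction (girth 2 (inj₁ (refl , u , v , 2≤m))) (≤⇒≯ (+-monoˡ-≤ 1 1≤r))
  ... | no  2≰m = ≤-pred (≰⇒> 2≰m)

  _⊆ᴾ_ : List (Fin n) → Subsetᶠ n → Set
  xs ⊆ᴾ P = All (λ z → P z ≡ true) xs

  length≤size : ∀ (P : Subsetᶠ n) {xs} → Unique xs → xs ⊆ᴾ P → length xs ≤ size P
  length≤size P {[]}     _          _             = z≤n
  length≤size P {x ∷ xs} (x∉xs ∷ u) (x∈P ∷ xs⊆P) =
    subst (suc (length xs) ≤_) (sym (Σ-delete P (λ _ → 1) x∈P))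
      (s≤s (length≤size (delete x P) u (All.zipWith still-in (x∉xs , xs⊆P))))
    where
    still-in : ∀ {z} → x ≢ z × P z ≡ true → delete x P z ≡ true
    still-in {z} (x≢z , z∈P) with z ≟ x
    ... | yes refl = contradiction refl x≢z
    ... | no _     = z∈P

  Maximal : Subsetᶠ n → Fin n → List (Fin n) → Set
  Maximal P y rest = ∀ z → P z ≡ true → Adj y z → z ∈ y ∷ rest

  record MaximalPath (P : Subsetᶠ n) (l : Fin n) : Set where
    constructor maximalPath
    field
      start   : Fin n
      rest    : List (Fin n)
      unique  : Unique (start ∷ rest)
      linked  : Linked Adj (start ∷ rest)
      inside  : (start ∷ rest) ⊆ᴾ P
      maximal : Maximal P start rest
      ends-at : end start rest ≡ l

  extend : ∀ (P : Subsetᶠ n) fuel y rest → Unique (y ∷ rest) → Linked Adj (y ∷ rest) → (y ∷ rest) ⊆ᴾ P →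
    size P ≤ length (y ∷ rest) + fuel → MaximalPath P (end y rest)
  extend P fuel y rest u link y∷rest⊆P size≤
    with any? (λ z → (P z ≟ᵇ true) ×-dec (1 ≤? mult G y z) ×-dec ¬? (z ∈? y ∷ rest))
  ... | no ¬extensible = maximalPath y rest u link y∷rest⊆P maximal refl
    where
    maximal : Maximal P y rest
    maximal z z∈P y~z with z ∈? y ∷ rest
    ... | yes z∈path = z∈path
    ... | no  z∉path = contradiction (z , z∈P , y~z , z∉path) ¬extensible
  ... | yes (z , z∈P , y~z , z∉path) with fuel
  ...   | zero  = contradiction (subst (size P ≤_) (+-identityʳ _) size≤)
                    (<⇒≱ (length≤size P (¬Any⇒All¬ _ z∉path ∷ u) (z∈P ∷ y∷rest⊆P)))
  ...   | suc f = extend P f z (y ∷ rest) (¬Any⇒All¬ _ z∉path ∷ u) (adj-sym y~z ∷ link) (z∈P ∷ y∷rest⊆P)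
                    (subst (size P ≤_) (+-suc _ f) size≤)

  degIn-no-neighbour : ∀ {P : Subsetᶠ n} {y} → (∀ z → P z ≡ true → ¬ Adj y z) → degIn y P ≡ 0
  degIn-no-neighbour {P} {y} none = sumℕ-zero termwise
    where
    termwise : ∀ z → 𝟙 (P z) * mult G y z ≡ 0
    termwise z with P z in z∈P
    ... | true  = cong (_+ 0) (¬adj⇒mult≡0 (none z z∈P))
    ... | false = refl

  degIn-one-neighbour : ∀ {P : Subsetᶠ n} {y} p → (∀ z → P z ≡ true → Adj y z → z ≡ p) → degIn y P ≤ 1
  degIn-one-neighbour {P} {y} p only-p =
    ≤-trans (sumℕ-mono-≤ termwise) (≤-reflexive (sumℕ-point p (λ _ → 1)))
    where
    termwise : ∀ z → 𝟙 (P z) * mult G y z ≤ 𝟙[ z ≟ p ] * 1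
    termwise z with P z in z∈P | z ≟ p
    ... | false | _        = z≤n
    ... | true  | yes refl = +-monoˡ-≤ 0 (mult≤1 y z)
    ... | true  | no z≢p   = ≤-reflexive (cong (_+ 0) (¬adj⇒mult≡0 (z≢p ∘ only-p z z∈P)))

  maximal-alone-isolated : ∀ {P : Subsetᶠ n} {y} → Maximal P y [] → degIn y P ≡ 0
  maximal-alone-isolated {y = y} maximal = degIn-no-neighbour λ z z∈P y~z → alone (maximal z z∈P y~z) y~z
    where
    alone : ∀ {z} → z ∈ y ∷ [] → ¬ Adj y z
    alone (here refl) = adj-irrefl

  maximal-end-degree≤1 : ∀ {P : Subsetᶠ n} {y rest} → Unique (y ∷ rest) → Linked Adj (y ∷ rest) →
    (y ∷ rest) ⊆ᴾ P → size P ≤ r + 1 → Maximal P y rest → degIn y P ≤ 1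
  maximal-end-degree≤1 {rest = []} _ _ _ _ maximal = ≤-trans (≤-reflexive (maximal-alone-isolated maximal)) z≤n
  maximal-end-degree≤1 {P} {y} {p ∷ rest} u link path⊆P small maximal = degIn-one-neighbour p only-p
    where
    only-p : ∀ z → P z ≡ true → Adj y z → z ≡ p
    only-p z z∈P y~z with maximal z z∈P y~z
    ... | here refl          = contradiction y~z adj-irrefl
    ... | there (here z≡p)   = z≡p
    ... | there (there z∈rest) with chord⇒cycle u link z∈rest y~z
    ...   | k , k≤len , cycle =
            contradiction (≤-trans k≤len (≤-trans (length≤size P u path⊆P) small)) (<⇒≱ (girth k cycle))

  nonempty : ∀ (P : Subsetᶠ n) → 1 ≤ size P → ∃ λ a → P a ≡ true
  nonempty P 1≤size with any? (λ a → P a ≟ᵇ true)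
  ... | yes a∈P = a∈P
  ... | no  ∄a  = contradiction (subst (1 ≤_) (Σ-empty P (λ _ → 1) (λ a → ¬-not (∄a ∘ (a ,_)))) 1≤size) λ ()

  unmarked-leaf : ∀ {P x} → degIn x P ≤ 1 → marked x ≡ false → degIn x P + 𝟙 (marked x) ≤ 1
  unmarked-leaf deg≤1 x-unmarked rewrite x-unmarked = subst (_≤ 1) (sym (+-identityʳ _)) deg≤1

  -- Extending twice yields a path in P whose two ends are both starts of maximal paths, hence
  -- have at most one neighbour in P; joined by a path of length at most r, they are not both marked.
  leaf : ∀ (P : Subsetᶠ n) → 1 ≤ size P → size P ≤ r + 1 → ∃ λ x → P x ≡ true × degIn x P + 𝟙 (marked x) ≤ 1
  leaf P 1≤size small with nonempty P 1≤size
  ... | a , a∈P with extend P (size P) a [] ([] ∷ []) [-] (a∈P ∷ []) (m≤n+m _ 1)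
  ... | maximalPath y₁ rest₁ u₁ link₁ inside₁@(y₁∈P ∷ _) maximal₁ _
      with extend P (size P) y₁ [] ([] ∷ []) [-] (y₁∈P ∷ []) (m≤n+m _ 1)
  ... | maximalPath y₂ [] _ _ (y₂∈P ∷ _) maximal₂ _ =
        y₂ , y₂∈P , subst (_≤ 1) (sym (cong (_+ 𝟙 (marked y₂)) (maximal-alone-isolated maximal₂))) (𝟙≤1 (marked y₂))
  ... | maximalPath y₂ (x ∷ xs) u₂@(y₂∉path ∷ _) link₂ inside₂@(y₂∈P ∷ _) maximal₂ ends₂
      with marked y₂ in y₂-mark | marked y₁ in y₁-mark
  ...   | false | _     = y₂ , y₂∈P , unmarked-leaf {P} (maximal-end-degree≤1 u₂ link₂ inside₂ small maximal₂) y₂-mark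
  ...   | true  | false = y₁ , y₁∈P , unmarked-leaf {P} (maximal-end-degree≤1 u₁ link₁ inside₁ small maximal₁) y₁-mark
  ...   | true  | true  = contradiction (subst (Reach G r y₂) ends₂ (reach-mono length≤r (linked⇒reach link₂)))
                                       (apart y₂ y₁ y₂-mark y₁-mark y₂≢y₁)
    where
    y₂≢y₁ : y₂ ≢ y₁
    y₂≢y₁ y₂≡y₁ = All.lookup y₂∉path (end-∈ x xs) (trans y₂≡y₁ (sym ends₂))
    length≤r : length (x ∷ xs) ≤ r
    length≤r = ≤-pred (≤-trans (length≤size P u₂ inside₂) (≤-trans small (≤-reflexive (+-comm r 1))))

  forest-bound : ∀ (P : Subsetᶠ n) → size P ≤ r + 1 → degSum P + 2 * marks marked P ≤ 2 * size P
  forest-bound P = bound (size P) P refl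
    where
    regroup : ∀ a b c d → 2 * a + b + 2 * (c + d) ≡ 2 * (a + c) + (b + 2 * d)
    regroup = solve-∀
    bound : ∀ k (P : Subsetᶠ n) → size P ≡ k → k ≤ r + 1 → degSum P + 2 * marks marked P ≤ 2 * k
    bound zero P size≡0 _ =
      ≤-reflexive (cong₂ (λ d m → d + 2 * m) (Σ-empty P _ (size-zero P size≡0)) (Σ-empty P _ (size-zero P size≡0)))
    bound (suc k) P size≡1+k small with leaf P (subst (1 ≤_) (sym size≡1+k) (s≤s z≤n)) (subst (_≤ r + 1) (sym size≡1+k) small)
    ... | x , x∈P , x-leaf = begin
      degSum P + 2 * marks marked P
        ≡⟨ cong₂ (λ d m → d + 2 * m) (degSum-delete x x∈P) (Σ-delete P (𝟙 ∘ marked) x∈P) ⟩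
      2 * degIn x P + degSum P′ + 2 * (𝟙 (marked x) + marks marked P′)
        ≡⟨ regroup (degIn x P) (degSum P′) (𝟙 (marked x)) (marks marked P′) ⟩
      2 * (degIn x P + 𝟙 (marked x)) + (degSum P′ + 2 * marks marked P′)
        ≤⟨ +-mono-≤ (*-monoʳ-≤ 2 x-leaf) (bound k P′ size′ (≤-trans (n≤1+n k) small)) ⟩
      2 * 1 + 2 * k
        ≡⟨ *-distribˡ-+ 2 1 k ⟨
      2 * suc k ∎
      where
      open ≤-Reasoning
      P′ : Subsetᶠ n
      P′ = delete x P
      size′ : size P′ ≡ k
      size′ = suc-injective (trans (sym (Σ-delete P (λ _ → 1) x∈P)) size≡1+k)

module Closure {n : ℕ} (G : MultiGraph n) (marked : Subsetᶠ n) (r : ℕ)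
  (mult≤1 : ∀ u v → mult G u v ≤ 1)
  (forest-bound : ∀ P → size P ≤ r + 1 → Induced.degSum G P + 2 * marks marked P ≤ 2 * size P)
  (E : Fin n → ℕ) (deg-E : sumℕ E ≡ r) where

  open Induced G

  chips : Subsetᶠ n → ℕ
  chips P = Σ[ P ] E

  chips≤r : ∀ P → chips P ≤ r
  chips≤r P = subst (chips P ≤_) deg-E (Σ≤sumℕ P E)

  gain : Fin n → Subsetᶠ n → ℕ
  gain x P = E x + 𝟙 (marked x) + degIn x P

  weight : Subsetᶠ n → ℕ
  weight P = 2 * chips P + 2 * marks marked P + degSum P

  weight-cong : ∀ {P Q} → (∀ i → P i ≡ Q i) → weight P ≡ weight Q
  weight-cong P≗Q = cong₂ _+_ (cong₂ (λ c m → 2 * c + 2 * m) (Σ-congˢ E P≗Q) (Σ-congˢ (𝟙 ∘ marked) P≗Q))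
                              (degSum-cong P≗Q)

  weight-insert : ∀ {P} x → P x ≡ false → weight (insert x P) ≡ 2 * gain x P + weight P
  weight-insert {P} x x∉P = begin
    weight (insert x P)
      ≡⟨ cong₂ _+_ (cong₂ (λ c m → 2 * c + 2 * m) (Σ-insert P E x∉P) (Σ-insert P (𝟙 ∘ marked) x∉P))
                   (degSum-insert x x∉P) ⟩
    2 * (E x + chips P) + 2 * (𝟙 (marked x) + marks marked P) + (2 * degIn x P + degSum P)
      ≡⟨ regroup (E x) (chips P) (𝟙 (marked x)) (marks marked P) (degIn x P) (degSum P) ⟩
    2 * gain x P + weight P ∎
    where
    open ≡-Reasoning
    regroup : ∀ e c m k d s → 2 * (e + c) + 2 * (m + k) + (2 * d + s) ≡ 2 * (e + m + d) + (2 * c + 2 * k + s)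
    regroup = solve-∀

  weight≤ : ∀ P → size P ≤ r + 1 → weight P ≤ 2 * chips P + 2 * size P
  weight≤ P small = begin
    weight P                                          ≡⟨ regroup (2 * chips P) (marks marked P) (degSum P) ⟩
    2 * chips P + (degSum P + 2 * marks marked P)     ≤⟨ +-monoʳ-≤ (2 * chips P) (forest-bound P small) ⟩
    2 * chips P + 2 * size P                          ∎
    where
    open ≤-Reasoning
    regroup : ∀ a m d → a + 2 * m + d ≡ a + (d + 2 * m)
    regroup = solve-∀

  size≤chips-of-weight : ∀ P → size P ≤ r + 1 → 4 * size P ≤ weight P → size P ≤ chips P
  size≤chips-of-weight P small heavy = *-cancelˡ-≤ 2 (+-cancelʳ-≤ (2 * size P) _ _ (begin
    2 * size P + 2 * size P  ≡⟨ double (size P) ⟩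
    4 * size P               ≤⟨ heavy ⟩
    weight P                 ≤⟨ weight≤ P small ⟩
    2 * chips P + 2 * size P ∎))
    where
    open ≤-Reasoning
    double : ∀ a → 2 * a + 2 * a ≡ 4 * a
    double = solve-∀

  gain≤1+gain-delete : ∀ {P} x t → P t ≡ true → gain x P ≤ 1 + gain x (delete t P)
  gain≤1+gain-delete {P} x t t∈P = begin
    E x + 𝟙 (marked x) + degIn x P                       ≡⟨ cong (_+_ (E x + 𝟙 (marked x))) (Σ-delete P (mult G x) t∈P) ⟩
    E x + 𝟙 (marked x) + (mult G x t + degIn x P′)
      ≤⟨ +-monoʳ-≤ (E x + 𝟙 (marked x)) (+-monoˡ-≤ (degIn x P′) (mult≤1 x t)) ⟩
    E x + 𝟙 (marked x) + (1 + degIn x P′)                ≡⟨ regroup (E x + 𝟙 (marked x)) (degIn x P′) ⟩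
    1 + gain x P′                                        ∎
    where
    open ≤-Reasoning
    P′ = delete t P
    regroup : ∀ a d → a + (1 + d) ≡ 1 + (a + d)
    regroup = solve-∀

  record Invariant (P : Subsetᶠ n) : Set where
    field
      weight-large        : 4 * size P ≤ weight P
      weight-large-delete : ∀ t → P t ≡ true → 2 * size (delete t P) ≤ weight (delete t P)
      size≤chips          : size P ≤ chips P

  invariant-∅ : Invariant ∅
  invariant-∅ = record
    { weight-large        = ≤-reflexive (trans (cong (4 *_) size-∅) (sym weight-∅))
    ; weight-large-delete = λ _ ()
    ; size≤chips          = ≤-reflexive (trans size-∅ (sym (Σ-empty (∅ {n}) E (λ _ → refl))))
    }
    where
    size-∅ : size (∅ {n}) ≡ 0
    size-∅ = Σ-empty (∅ {n}) (λ _ → 1) (λ _ → refl)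
    weight-∅ : weight ∅ ≡ 0
    weight-∅ = cong₂ _+_ (cong₂ (λ c m → 2 * c + 2 * m) (Σ-empty (∅ {n}) E (λ _ → refl))
                                                       (Σ-empty (∅ {n}) (𝟙 ∘ marked) (λ _ → refl)))
                         (Σ-empty (∅ {n}) (λ y → degIn y ∅) (λ _ → refl))

  weight-insert-≥ : ∀ {P} x k → P x ≡ false → k ≤ 2 * gain x P →
    k * size P ≤ weight P → k * size (insert x P) ≤ weight (insert x P)
  weight-insert-≥ {P} x k x∉P k≤gain heavy = begin
    k * size (insert x P)      ≡⟨ cong (k *_) (Σ-insert P (λ _ → 1) x∉P) ⟩
    k * (1 + size P)           ≡⟨ *-distribˡ-+ k 1 (size P) ⟩
    k * 1 + k * size P         ≤⟨ +-mono-≤ (≤-trans (≤-reflexive (*-identityʳ k)) k≤gain) heavy ⟩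
    2 * gain x P + weight P    ≡⟨ weight-insert x x∉P ⟨
    weight (insert x P)        ∎
    where open ≤-Reasoning

  invariant-insert : ∀ {P} x → Invariant P → P x ≡ false → 2 ≤ gain x P → Invariant (insert x P)
  invariant-insert {P} x inv x∉P 2≤gain = record
    { weight-large        = heavy
    ; weight-large-delete = large-delete
    ; size≤chips          = size≤chips-of-weight (insert x P) small heavy
    }
    where
    open Invariant inv
    heavy : 4 * size (insert x P) ≤ weight (insert x P)
    heavy = weight-insert-≥ x 4 x∉P (*-monoʳ-≤ 2 2≤gain) weight-large
    small : size (insert x P) ≤ r + 1
    small = begin
      size (insert x P) ≡⟨ Σ-insert P (λ _ → 1) x∉P ⟩
      1 + size P        ≤⟨ +-monoʳ-≤ 1 (≤-trans size≤chips (chips≤r P)) ⟩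
      1 + r             ≡⟨ +-comm 1 r ⟩
      r + 1             ∎
      where open ≤-Reasoning
    large-delete : ∀ t → insert x P t ≡ true → 2 * size (delete t (insert x P)) ≤ weight (delete t (insert x P))
    large-delete t t∈P+x with t ≟ x
    ... | yes refl = subst₂ (λ c w → 2 * c ≤ w) (sym (Σ-congˢ (λ _ → 1) (delete-insert {P = P} x∉P)))
                            (sym (weight-cong (delete-insert {P = P} x∉P)))
                            (≤-trans (*-monoˡ-≤ (size P) (m≤m+n 2 2)) weight-large)
    ... | no t≢x   = subst₂ (λ c w → 2 * c ≤ w) (sym (Σ-congˢ (λ _ → 1) commute)) (sym (weight-cong commute))
                            (weight-insert-≥ x 2 x∉Q (*-monoʳ-≤ 2 1≤gain) (weight-large-delete t t∈P+x))
      where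
      Q : Subsetᶠ n
      Q = delete t P
      commute : ∀ i → delete t (insert x P) i ≡ insert x Q i
      commute = delete-insert-comm P t≢x
      x∉Q : Q x ≡ false
      x∉Q = trans (cong (not (does (x ≟ t)) ∧_) x∉P) (∧-zeroʳ _)
      1≤gain : 1 ≤ gain x Q
      1≤gain = ≤-pred (≤-trans 2≤gain (gain≤1+gain-delete x t t∈P+x))

  record Stable : Set where
    field
      U         : Subsetᶠ n
      invariant : Invariant U
      outside   : ∀ x → U x ≡ false → gain x U ≤ 1

  close : ∀ fuel P → Invariant P → n ≤ size P + fuel → Stable
  close fuel P inv n≤ with any? (λ x → (P x ≟ᵇ false) ×-dec (2 ≤? gain x P))
  ... | no ∄x = record { U = P ; invariant = inv ; outside = λ x x∉P → ≤-pred (≰⇒> (∄x ∘ (x ,_) ∘ (x∉P ,_))) }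
  ... | yes (x , x∉P , 2≤gain) with fuel
  ...   | zero  = contradiction (subst (n ≤_) (+-identityʳ _) n≤)
                    (<⇒≱ (subst (_≤ n) (Σ-insert P (λ _ → 1) x∉P) (size≤n (insert x P))))
  ...   | suc f = close f (insert x P) (invariant-insert x inv x∉P 2≤gain)
                    (subst (n ≤_) (trans (+-suc (size P) f) (cong (_+ f) (sym (Σ-insert P (λ _ → 1) x∉P)))) n≤)

  stable : Stable
  stable = close n ∅ invariant-∅ (m≤n+m n (size (∅ {n})))

  inside : ∀ {U} → Invariant U → ∀ w → U w ≡ true → gain w U ≤ chips U + 1
  inside {U} inv w w∈U = *-cancelˡ-≤ 2 (+-cancelʳ-≤ (2 * size Q) _ _ (begin
    2 * gain w U + 2 * size Q       ≤⟨ +-monoʳ-≤ (2 * gain w U) (weight-large-delete w w∈U) ⟩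
    2 * gain w U + weight Q         ≡⟨ cong (λ g → 2 * g + weight Q) same-gain ⟩
    2 * gain w Q + weight Q         ≡⟨ weight-insert w (delete-self U w) ⟨
    weight (insert w Q)             ≡⟨ weight-cong (insert-delete w∈U) ⟩
    weight U                        ≤⟨ weight≤ U small ⟩
    2 * chips U + 2 * size U        ≡⟨ cong (λ c → 2 * chips U + 2 * c) (Σ-delete U (λ _ → 1) w∈U) ⟩
    2 * chips U + 2 * (1 + size Q)  ≡⟨ regroup (chips U) (size Q) ⟩
    2 * (chips U + 1) + 2 * size Q  ∎))
    where
    open ≤-Reasoning
    open Invariant inv
    Q : Subsetᶠ n
    Q = delete w U
    same-gain : gain w U ≡ gain w Q
    same-gain = cong (_+_ (E w + 𝟙 (marked w))) (degIn-delete-self w w∈U)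
    small : size U ≤ r + 1
    small = ≤-trans size≤chips (≤-trans (chips≤r U) (m≤m+n r 1))
    regroup : ∀ c s → 2 * c + 2 * (1 + s) ≡ 2 * (c + 1) + 2 * s
    regroup = solve-∀

  gain-bound : ∀ {P} x k → gain x P ≤ k + 1 → E x + degIn x P ≤ k + 𝟙 (not (marked x))
  gain-bound {P} x k bound = +-cancelʳ-≤ (𝟙 (marked x)) _ _ (begin
    E x + degIn x P + 𝟙 (marked x)              ≡⟨ regroup (E x) (degIn x P) (𝟙 (marked x)) ⟩
    gain x P                                    ≤⟨ bound ⟩
    k + 1                                       ≡⟨ cong (_+_ k) (sym (𝟙-not+𝟙 (marked x))) ⟩
    k + (𝟙 (not (marked x)) + 𝟙 (marked x))    ≡⟨ +-assoc k _ _ ⟨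
    k + 𝟙 (not (marked x)) + 𝟙 (marked x)      ∎)
    where
    open ≤-Reasoning
    regroup : ∀ e d m → e + d + m ≡ e + m + d
    regroup = solve-∀

  U : Subsetᶠ n
  U = Stable.U stable

  U-inside : ∀ w → U w ≡ true → E w + degIn w U ≤ r + 𝟙 (not (marked w))
  U-inside w w∈U = gain-bound {U} w r (≤-trans (inside (Stable.invariant stable) w w∈U) (+-monoˡ-≤ 1 (chips≤r U)))

  U-outside : ∀ w → U w ≡ false → E w + degIn w U ≤ 𝟙 (not (marked w))
  U-outside w w∉U = gain-bound {U} w 0 (Stable.outside stable w w∉U)

+-−-interchange : ∀ a b c d → (+ a - + b) ℤ.+ (+ c - + d) ≡ + (a + c) - + (b + d)
+-−-interchange a b c d =
  trans (interchange (+ a) (+ b) (+ c) (+ d)) (sym (cong₂ _-_ (ℤₚ.pos-+ a c) (ℤₚ.pos-+ b d)))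
  where
  interchange : ∀ (a b c d : ℤ) → (a - b) ℤ.+ (c - d) ≡ (a ℤ.+ c) - (b ℤ.+ d)
  interchange = ℤ-Solver.solve-∀

+[m+n]-n : ∀ m n → + (m + n) - + n ≡ + m
+[m+n]-n m n = trans (cong (_- + n) (ℤₚ.pos-+ m n)) (cancel (+ m) (+ n))
  where
  cancel : ∀ (a b : ℤ) → (a ℤ.+ b) - b ≡ a
  cancel = ℤ-Solver.solve-∀

sumℤ-+ : ∀ {n} (f : Fin n → ℕ) → sumℤ (λ i → + f i) ≡ + sumℕ f
sumℤ-+ {zero}  f = refl
sumℤ-+ {suc n} f = cong (ℤ._+_ (+ f zero)) (sumℤ-+ (f ∘ suc))

module SetFiring {n : ℕ} (G : MultiGraph n) where

  open Induced G

  fire-≡ : ∀ v (D : Divisor n) w → fire G v D w ≡ D w ℤ.+ (+ mult G v w - + (𝟙[ v ≟ w ] * val G v))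
  fire-≡ v D w with w ≟ v | v ≟ w
  ... | yes refl | yes _    rewrite loopless G w | +-identityʳ (val G w) = cong (ℤ._+_ (D w)) (sym (ℤₚ.+-identityˡ _))
  ... | yes refl | no w≢w   = contradiction refl w≢w
  ... | no w≢v   | yes refl = contradiction refl w≢v
  ... | no _     | no _     = cong (ℤ._+_ (D w)) (sym (ℤₚ.+-identityʳ _))

  fireList-≡ : ∀ vs (D : Divisor n) w → fireList G vs D w ≡
    D w ℤ.+ (+ sum (map (λ v → mult G v w) vs) - + sum (map (λ v → 𝟙[ v ≟ w ] * val G v) vs))
  fireList-≡ []       D w = sym (ℤₚ.+-identityʳ (D w))
  fireList-≡ (v ∷ vs) D w = begin
    fireList G vs (fire G v D) w
      ≡⟨ fireList-≡ vs (fire G v D) w ⟩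
    fire G v D w ℤ.+ (+ sum (map gained vs) - + sum (map lost vs))
      ≡⟨ cong (ℤ._+ (+ sum (map gained vs) - + sum (map lost vs))) (fire-≡ v D w) ⟩
    D w ℤ.+ (+ gained v - + lost v) ℤ.+ (+ sum (map gained vs) - + sum (map lost vs))
      ≡⟨ ℤₚ.+-assoc (D w) _ _ ⟩
    D w ℤ.+ ((+ gained v - + lost v) ℤ.+ (+ sum (map gained vs) - + sum (map lost vs)))
      ≡⟨ cong (ℤ._+_ (D w)) (+-−-interchange (gained v) (lost v) _ _) ⟩
    D w ℤ.+ (+ sum (map gained (v ∷ vs)) - + sum (map lost (v ∷ vs))) ∎
    where
    open ≡-Reasoning
    gained lost : Fin n → ℕ
    gained v = mult G v w
    lost v = 𝟙[ v ≟ w ] * val G v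

  -- Firing every vertex outside U once: a vertex of U gains its edges to the outside,
  -- a vertex outside U loses its edges into U.
  fire-complement-effective : ∀ (D E : Fin n → ℕ) (U : Subsetᶠ n) →
    (∀ w → U w ≡ true → E w + degIn w U ≤ val G w + D w) →
    (∀ w → U w ≡ false → E w + degIn w U ≤ D w) →
    EquivEffective G (λ w → + D w - + E w)
  fire-complement-effective D E U inside outside = elements (∁ U) , nonnegative
    where
    out : Fin n → ℕ
    out w = Σ[ ∁ U ] (mult G w)
    val-split : ∀ w → val G w ≡ degIn w U + out w
    val-split w = sumℕ-split U (mult G w)
    value : ∀ w → fireList G (elements (∁ U)) (λ w → + D w - + E w) w ≡
                  + (D w + out w) - + (E w + 𝟙 (∁ U w) * val G w)
    value w = begin
      fireList G (elements (∁ U)) (λ w → + D w - + E w) w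
        ≡⟨ fireList-≡ (elements (∁ U)) (λ w → + D w - + E w) w ⟩
      (+ D w - + E w) ℤ.+ (+ sum (map (λ v → mult G v w) (elements (∁ U)))
                           - + sum (map (λ v → 𝟙[ v ≟ w ] * val G v) (elements (∁ U))))
        ≡⟨ cong₂ (λ a b → (+ D w - + E w) ℤ.+ (+ a - + b))
                 (trans (sum-elements (∁ U) _) (Σ-congᶠ (∁ U) (λ v _ → symm G v w)))
                 (trans (sum-elements (∁ U) _) (Σ-point (∁ U) w (val G))) ⟩
      (+ D w - + E w) ℤ.+ (+ out w - + (𝟙 (∁ U w) * val G w))
        ≡⟨ +-−-interchange (D w) (E w) (out w) _ ⟩
      + (D w + out w) - + (E w + 𝟙 (∁ U w) * val G w) ∎
      where open ≡-Reasoning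
    balance : ∀ w b → U w ≡ b → E w + 𝟙 (∁ U w) * val G w ≤ D w + out w
    balance w true w∈U rewrite w∈U = +-cancelˡ-≤ (degIn w U) _ _ (begin
      degIn w U + (E w + 0)    ≡⟨ cong (_+_ (degIn w U)) (+-identityʳ (E w)) ⟩
      degIn w U + E w          ≡⟨ +-comm (degIn w U) (E w) ⟩
      E w + degIn w U          ≤⟨ inside w w∈U ⟩
      val G w + D w            ≡⟨ cong (_+ D w) (val-split w) ⟩
      degIn w U + out w + D w  ≡⟨ regroup (degIn w U) (out w) (D w) ⟩
      degIn w U + (D w + out w) ∎)
      where
      open ≤-Reasoning
      regroup : ∀ d o e → d + o + e ≡ d + (e + o)
      regroup = solve-∀
    balance w false w∉U rewrite w∉U = begin
      E w + (val G w + 0)        ≡⟨ cong (_+_ (E w)) (trans (+-identityʳ (val G w)) (val-split w)) ⟩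
      E w + (degIn w U + out w)  ≡⟨ +-assoc (E w) _ _ ⟨
      E w + degIn w U + out w    ≤⟨ +-monoˡ-≤ (out w) (outside w w∉U) ⟩
      D w + out w                ∎
      where open ≤-Reasoning
    nonnegative : ∀ w → + 0 ℤ.≤ fireList G (elements (∁ U)) (λ w → + D w - + E w) w
    nonnegative w = subst (+ 0 ℤ.≤_) (sym (value w)) (ℤₚ.i≤j⇒0≤j-i (+≤+ (balance w (U w) refl)))

unmarked+∣S∣≡n : ∀ {n} (S : Subset n) → sumℕ (λ i → 𝟙 (not (Vec.lookup S i))) + ∣ S ∣ ≡ n
unmarked+∣S∣≡n []          = refl
unmarked+∣S∣≡n (true ∷ S)  = trans (+-suc _ _) (cong suc (unmarked+∣S∣≡n S))
unmarked+∣S∣≡n (false ∷ S) = cong suc (unmarked+∣S∣≡n S)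

theorem1p2 : (r : ℕ) → 1 ≤ r → (n : ℕ) → (G : MultiGraph n) → Connected G →
    MinValAtLeast G r → GirthGreaterThan G (r + 1) →
    (S : Subset n) → Independent G r S →
    ∃ λ (D : Divisor n) → RankAtLeast G D r × deg D ℤ.≤ + n - + ∣ S ∣
theorem1p2 r 1≤r n G _ min-val girth S independent = (λ w → + unmarked w) , rank , degree
  where
  marked : Subsetᶠ n
  marked = Vec.lookup S
  unmarked : Fin n → ℕ
  unmarked w = 𝟙 (not (marked w))
  apart : ∀ u v → marked u ≡ true → marked v ≡ true → u ≢ v → ¬ Reach G r u v
  apart u v u∈S v∈S = independent u v (lookup⇒[]= u S u∈S) (lookup⇒[]= v S v∈S)
  open Forest r 1≤r G girth marked apart using (mult≤1; forest-bound)
  rank : RankAtLeast G (λ w → + unmarked w) r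
  rank E deg-E = SetFiring.fire-complement-effective G unmarked E U
    (λ w w∈U → ≤-trans (U-inside w w∈U) (+-monoˡ-≤ (unmarked w) (min-val w))) U-outside
    where open Closure G marked r mult≤1 forest-bound E deg-E using (U; U-inside; U-outside)
  degree : sumℤ (λ w → + unmarked w) ℤ.≤ + n - + ∣ S ∣
  degree = ℤₚ.≤-reflexive (begin
    sumℤ (λ w → + unmarked w)           ≡⟨ sumℤ-+ unmarked ⟩
    + sumℕ unmarked                     ≡⟨ +[m+n]-n (sumℕ unmarked) ∣ S ∣ ⟨
    + (sumℕ unmarked + ∣ S ∣) - + ∣ S ∣ ≡⟨ cong (λ m → + m - + ∣ S ∣) (unmarked+∣S∣≡n S) ⟩
    + n - + ∣ S ∣                       ∎)
    where open ≡-Reasoning
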